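{- Let $l\geq 3$ be an integer, let $H$ be a $3$-uniform hypergraph containing no $3$-uniform loose cycle of length $l$, and let $(X,Y)$ be an extender in $H$. Then $X$ contains a subset $Z$ which is independent in $H^*$ and has size at least $|X|/(l-2)$.
   Context: A loose cycle of length $l$ is a hypergraph with $l$ edges $e_1,\dots,e_l$ such that $|e_i\cap e_j|=1$ whenever $j\equiv i\pm1 \pmod l$ and $e_i\cap e_j=\emptyset$ otherwise. A set $Z$ is independent in a hypergraph if no edge of that hypergraph is contained in $Z$. Light/heavy (depending on $l$): a pair of vertices is heavy in $H$ if it lies in at least $2l-2$ edges of $H$, light otherwise; an edge of $H$ is light if it contains no heavy pair. $H^*$ is the hypergraph with vertex set $V(H)$ whose edges are the light edges of $H$ together with all heavy pairs (as 2-element edges). A path of length $k$ is a hypergraph with edges $e_1,\dots,e_k$, each of size at least 2, such that for $i<j$, $e_i\cap e_j=\emptyset$ unless $j=i+1$, in which case $e_i\cap e_{i+1}\neq\emptyset$; it is simple if distinct edges share at most one vertex, and it joins $a$ to $b$ if $a\in e_1\setminus e_2$ and $b\in e_k\setminus e_{k-1}$. An extender in $H$ is a pair $(X,Y)$ of disjoint subsets of $V(H)$ such that (1) for any distinct $u,v\in X$ and any set $S\subseteq V(H)\setminus(\{u,v\}\cup Y)$ with $|S|\leq 2l-5$, there is a simple path of length two in $H$ joining $u$ to $v$ containing no element of $S$; and (2) $|Y|\leq 2|X|$. -}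

module Defs where

open import Data.Nat using (ℕ; zero; suc; _+_; _*_; _∸_; _≤_)
open import Data.Fin using (Fin; toℕ)
open import Data.Fin.Subset using (Subset; _∈_; _∉_; _⊆_; _∩_; _∪_; ∣_∣; ⁅_⁆)
open import Data.Fin.Subset.Properties using (_∈?_)
open import Data.List using (List; filter; length)
open import Data.List.Relation.Unary.All using (All)
open import Data.List.Relation.Unary.Unique.Propositional using (Unique)
import Data.List.Membership.Propositional as L
open import Data.Product using (Σ; ∃; ∃-syntax; _×_; _,_)
open import Data.Sum using (_⊎_)
open import Relation.Nullary using (¬_)
open import Relation.Nullary.Decidable using (_×-dec_)
open import Relation.Binary.PropositionalEquality using (_≡_; _≢_)

record Hypergraph3 (n : ℕ) : Set where
  field
    edges   : List (Subset n)
    unique  : Unique edges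
    uniform : All (λ e → ∣ e ∣ ≡ 3) edges
open Hypergraph3 public

module _ {n : ℕ} where

  Disjoint : Subset n → Subset n → Set
  Disjoint p q = ∀ x → ¬ (x ∈ p × x ∈ q)

  IsEdge : Hypergraph3 n → Subset n → Set
  IsEdge H e = e L.∈ edges H

  codeg : Hypergraph3 n → Fin n → Fin n → ℕ
  codeg H u v = length (filter (λ e → (u ∈? e) ×-dec (v ∈? e)) (edges H))

  Heavy : ℕ → Hypergraph3 n → Fin n → Fin n → Set
  Heavy l H u v = u ≢ v × (2 * l ∸ 2) ≤ codeg H u v

  LightEdge : ℕ → Hypergraph3 n → Subset n → Set
  LightEdge l H e = IsEdge H e ×
    (∀ u v → u ∈ e → v ∈ e → ¬ Heavy l H u v)

  StarEdge : ℕ → Hypergraph3 n → Subset n → Set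
  StarEdge l H e = LightEdge l H e ⊎
    (∃[ u ] ∃[ v ] (Heavy l H u v × e ≡ ⁅ u ⁆ ∪ ⁅ v ⁆))

  Independent : (Subset n → Set) → Subset n → Set
  Independent G Z = ∀ e → G e → ¬ (e ⊆ Z)

  SimplePath2Avoiding : Hypergraph3 n → Fin n → Fin n → Subset n → Set
  SimplePath2Avoiding H u v S = ∃[ e₁ ] ∃[ e₂ ]
    ( IsEdge H e₁ × IsEdge H e₂
    × (∃[ x ] (x ∈ e₁ × x ∈ e₂))
    × ∣ e₁ ∩ e₂ ∣ ≤ 1
    × (u ∈ e₁ × u ∉ e₂) × (v ∈ e₂ × v ∉ e₁)
    × Disjoint S (e₁ ∪ e₂) )

  Extender : ℕ → Hypergraph3 n → Subset n → Subset n → Set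
  Extender l H X Y = Disjoint X Y
    × (∀ u v → u ∈ X → v ∈ X → u ≢ v →
         ∀ (S : Subset n) →
         (∀ x → x ∈ S → x ≢ u × x ≢ v × x ∉ Y) →
         ∣ S ∣ ≤ 2 * l ∸ 5 →
         SimplePath2Avoiding H u v S)
    × ∣ Y ∣ ≤ 2 * ∣ X ∣

CycNext : {l : ℕ} → Fin l → Fin l → Set
CycNext {l} i j = suc (toℕ i) ≡ toℕ j ⊎ (suc (toℕ i) ≡ l × toℕ j ≡ 0)

CycAdj : {l : ℕ} → Fin l → Fin l → Set
CycAdj i j = CycNext i j ⊎ CycNext j i

ContainsLooseCycle : {n : ℕ} → ℕ → Hypergraph3 n → Set
ContainsLooseCycle {n} l H = Σ (Fin l → Subset n) λ c →
    (∀ i → IsEdge H (c i))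
  × (∀ i j → i ≢ j →
       (CycAdj i j → ∣ c i ∩ c j ∣ ≡ 1)
     × (¬ CycAdj i j → Disjoint (c i) (c j)))

-- Order the vertices by their index and let a step a < b be a pair of vertices of X that is
-- heavy, or that are the least and greatest vertex of a light edge inside X.  Colouring every
-- vertex by the length of a longest chain of steps ending in it (Mirsky), each colour class is
-- independent in H*, since a heavy pair or a light edge inside it would be a step between two
-- vertices of the same colour.  So if all colours are below l - 2, the largest class has at least
-- |X| / (l - 2) elements.  Otherwise there is a chain A (l-2) < ... < A 0 of l - 2 steps, and it
-- closes up into a loose cycle: a light step brings its own edge, whose middle vertex lies strictly
-- between the two ends of the step; the extender joins A (l-2) to A 0 by a simple 2-path avoiding
-- the inner chain vertices and the light middles (at most 2l - 5 vertices of X); finally the heavy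
-- steps, one after another, get an edge whose third vertex avoids the at most 2l - 3 other vertices
-- of the cycle, which is possible because a heavy pair lies in at least 2l - 2 edges.
module Submission where

open import Defs
open import Data.Nat using (ℕ; _≤_; _*_; _∸_)
open import Data.Fin.Subset using (Subset; _⊆_; ∣_∣)
open import Data.Product using (∃-syntax; _×_)
open import Relation.Nullary using (¬_)

open import Data.Empty using (⊥-elim) renaming (⊥ to Empty)
open import Data.Fin using (Fin; toℕ; _≟_)
open import Data.Fin.Properties using (any?; all?; toℕ-injective; toℕ<n)
open import Data.Fin.Subset using (_∈_; _∉_; _∪_; _∩_; _-_; ⁅_⁆; ⊥; inside; outside)
open import Data.Fin.Subset.Properties
  using (_∈?_; _⊆?_; nonempty?; ∩-comm; x∈p∪q⁺; x∈p∪q⁻; x∈p∩q⁺; x∈p∩q⁻; x∈⁅x⁆; x∈⁅y⁆⇒x≡y; ∉⊥;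
         ∣⊥∣≡0; ∣⁅x⁆∣≡1; p⊆q⇒∣p∣≤∣q∣; ⊆-antisym; x∈p⇒∣p-x∣<∣p∣; x∈p∧x≢y⇒x∈p-y)
open import Data.List using (List; []; _∷_; _++_; length; foldr; filter; map; allFin; upTo; applyUpTo)
open import Data.List.Extrema.Nat
  using (max; xs≤max; argmin; argmax; argmin-all; argmax-all; argmax-sel; f[argmin]≤f[xs]; f[xs]≤f[argmax])
open import Data.List.Membership.Propositional using (find; lose) renaming (_∈_ to _∈ˡ_)
open import Data.List.Membership.Propositional.Properties
  using (∈-filter⁺; ∈-filter⁻; ∈-map⁺; ∈-map⁻; ∈-allFin; ∈-upTo⁺; ∈-applyUpTo⁺; ∈-applyUpTo⁻;
         ∈-++⁺ˡ; ∈-++⁺ʳ; ∈-++⁻)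
open import Data.List.Properties
  using (filter-≐; map-cong-local; length-++; length-map; length-filter; length-applyUpTo; length-upTo)
open import Data.List.Relation.Unary.All as All using (All; []; _∷_)
open import Data.List.Relation.Unary.All.Properties using (all-filter; filter⁺)
open import Data.List.Relation.Unary.All.Properties.Core using (¬Any⇒All¬)
import Data.List.Relation.Unary.Any as Any
open import Data.List.Relation.Unary.Any using (here; there)
open import Data.List.Relation.Unary.AllPairs using ([]; _∷_)
open import Data.List.Relation.Unary.Unique.Propositional using (Unique)
import Data.List.Relation.Unary.Unique.Propositional.Properties as Unique
open import Data.Nat using (zero; suc; _+_; _<_; z≤n; s≤s; _≤?_; _<?_) renaming (_≟_ to _≟ℕ_)
open import Data.Nat.Properties hiding (_≟_)
open import Data.Nat.Tactic.RingSolver using (solve-∀)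
open import Data.Product using (_,_; proj₁; proj₂; swap)
open import Data.Sum using (_⊎_; inj₁; inj₂)
open import Data.Vec using ([]; _∷_; tabulate)
open import Data.Vec.Properties using (lookup⇒[]=; []=⇒lookup; lookup∘tabulate)
open import Function using (_∘_; id)
open import Relation.Binary.Definitions using (tri<; tri≈; tri>)
open import Relation.Binary.PropositionalEquality
  using (_≡_; _≢_; refl; sym; trans; cong; cong₂; subst; ≢-sym)
open import Relation.Nullary using (Dec; yes; no; does)
open import Relation.Nullary.Decidable using (¬?; _×-dec_; _⊎-dec_; _→-dec_; decidable-stable; dec-true)

∣p∪q∣≤∣p∣+∣q∣ : ∀ {n} (p q : Subset n) → ∣ p ∪ q ∣ ≤ ∣ p ∣ + ∣ q ∣
∣p∪q∣≤∣p∣+∣q∣ []            []            = z≤n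
∣p∪q∣≤∣p∣+∣q∣ (inside  ∷ p) (inside  ∷ q) = s≤s (≤-trans (∣p∪q∣≤∣p∣+∣q∣ p q) (+-monoʳ-≤ ∣ p ∣ (n≤1+n ∣ q ∣)))
∣p∪q∣≤∣p∣+∣q∣ (inside  ∷ p) (outside ∷ q) = s≤s (∣p∪q∣≤∣p∣+∣q∣ p q)
∣p∪q∣≤∣p∣+∣q∣ (outside ∷ p) (inside  ∷ q) = ≤-trans (s≤s (∣p∪q∣≤∣p∣+∣q∣ p q)) (≤-reflexive (sym (+-suc ∣ p ∣ ∣ q ∣)))
∣p∪q∣≤∣p∣+∣q∣ (outside ∷ p) (outside ∷ q) = ∣p∪q∣≤∣p∣+∣q∣ p q

module _ {n : ℕ} where

  fromList : List (Fin n) → Subset n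
  fromList = foldr (λ x p → ⁅ x ⁆ ∪ p) ⊥

  ∈-fromList⁺ : ∀ {x xs} → x ∈ˡ xs → x ∈ fromList xs
  ∈-fromList⁺ (here refl)  = x∈p∪q⁺ (inj₁ (x∈⁅x⁆ _))
  ∈-fromList⁺ (there x∈xs) = x∈p∪q⁺ (inj₂ (∈-fromList⁺ x∈xs))

  ∈-fromList⁻ : ∀ {x} xs → x ∈ fromList xs → x ∈ˡ xs
  ∈-fromList⁻ []       x∈ = ⊥-elim (∉⊥ x∈)
  ∈-fromList⁻ (y ∷ ys) x∈ with x∈p∪q⁻ ⁅ y ⁆ (fromList ys) x∈
  ... | inj₁ x∈⁅y⁆ = here (x∈⁅y⁆⇒x≡y y x∈⁅y⁆)
  ... | inj₂ x∈ys  = there (∈-fromList⁻ ys x∈ys)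

  ∣fromList∣≤length : ∀ xs → ∣ fromList xs ∣ ≤ length xs
  ∣fromList∣≤length []       = ≤-reflexive (∣⊥∣≡0 n)
  ∣fromList∣≤length (x ∷ xs) = ≤-trans (∣p∪q∣≤∣p∣+∣q∣ ⁅ x ⁆ (fromList xs))
    (+-mono-≤ (≤-reflexive (∣⁅x⁆∣≡1 x)) (∣fromList∣≤length xs))

  length≤∣p∣ : ∀ {p : Subset n} xs → Unique xs → All (_∈ p) xs → length xs ≤ ∣ p ∣
  length≤∣p∣         []       _             _          = z≤n
  length≤∣p∣ {p = p} (x ∷ xs) (x∉xs ∷ xs!) (x∈p ∷ xs⊆p) =
    ≤-trans (s≤s (length≤∣p∣ xs xs! (All.zipWith ∈p-x (x∉xs , xs⊆p)))) (x∈p⇒∣p-x∣<∣p∣ x∈p)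
    where
    ∈p-x : ∀ {y} → x ≢ y × y ∈ p → y ∈ p - x
    ∈p-x (x≢y , y∈p) = x∈p∧x≢y⇒x∈p-y y∈p (λ y≡x → x≢y (sym y≡x))

  ∣p∣≤1⇒≡ : ∀ {p : Subset n} {x y} → ∣ p ∣ ≤ 1 → x ∈ p → y ∈ p → x ≡ y
  ∣p∣≤1⇒≡ {x = x} {y} ∣p∣≤1 x∈p y∈p with x ≟ y
  ... | yes x≡y = x≡y
  ... | no  x≢y = ⊥-elim (<⇒≱ (s≤s (s≤s z≤n))
                    (≤-trans (length≤∣p∣ (x ∷ y ∷ []) ((x≢y ∷ []) ∷ [] ∷ []) (x∈p ∷ y∈p ∷ [])) ∣p∣≤1))

  ∣p∣≡1 : ∀ {p : Subset n} {x} → x ∈ p → (∀ {y} → y ∈ p → y ≡ x) → ∣ p ∣ ≡ 1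
  ∣p∣≡1 {p} {x} x∈p only-x = trans (cong ∣_∣ p≡⁅x⁆) (∣⁅x⁆∣≡1 x)
    where
    p≡⁅x⁆ : p ≡ ⁅ x ⁆
    p≡⁅x⁆ = ⊆-antisym (λ y∈p → subst (_∈ ⁅ x ⁆) (sym (only-x y∈p)) (x∈⁅x⁆ x))
                      (λ y∈⁅x⁆ → subst (_∈ p) (sym (x∈⁅y⁆⇒x≡y x y∈⁅x⁆)) x∈p)

  triple : Fin n → Fin n → Fin n → Subset n
  triple x y z = ⁅ x ⁆ ∪ ⁅ y ⁆ ∪ ⁅ z ⁆

  module _ {x y z : Fin n} where

    x∈triple : x ∈ triple x y z
    x∈triple = x∈p∪q⁺ (inj₁ (x∈⁅x⁆ x))

    y∈triple : y ∈ triple x y z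
    y∈triple = x∈p∪q⁺ (inj₂ (x∈p∪q⁺ (inj₁ (x∈⁅x⁆ y))))

    z∈triple : z ∈ triple x y z
    z∈triple = x∈p∪q⁺ (inj₂ (x∈p∪q⁺ (inj₂ (x∈⁅x⁆ z))))

    ∈-triple⁻ : ∀ {t} → t ∈ triple x y z → t ≡ x ⊎ t ≡ y ⊎ t ≡ z
    ∈-triple⁻ t∈ with x∈p∪q⁻ ⁅ x ⁆ _ t∈
    ... | inj₁ t∈x = inj₁ (x∈⁅y⁆⇒x≡y x t∈x)
    ... | inj₂ t∈yz with x∈p∪q⁻ ⁅ y ⁆ ⁅ z ⁆ t∈yz
    ...   | inj₁ t∈y = inj₂ (inj₁ (x∈⁅y⁆⇒x≡y y t∈y))
    ...   | inj₂ t∈z = inj₂ (inj₂ (x∈⁅y⁆⇒x≡y z t∈z))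

    module _ {e : Subset n} (∣e∣≡3 : ∣ e ∣ ≡ 3) (x∈e : x ∈ e) (y∈e : y ∈ e) (z∈e : z ∈ e)
             (x≢y : x ≢ y) (x≢z : x ≢ z) (y≢z : y ≢ z) where

      ⊆triple : e ⊆ triple x y z
      ⊆triple {t} t∈e with t ≟ x | t ≟ y | t ≟ z
      ... | yes refl | _        | _        = x∈triple
      ... | no _     | yes refl | _        = y∈triple
      ... | no _     | no _     | yes refl = z∈triple
      ... | no t≢x   | no t≢y   | no t≢z   = ⊥-elim (<⇒≱ ≤-refl (≤-trans
              (length≤∣p∣ (t ∷ x ∷ y ∷ z ∷ []) ((t≢x ∷ t≢y ∷ t≢z ∷ []) ∷ (x≢y ∷ x≢z ∷ []) ∷ (y≢z ∷ []) ∷ [] ∷ [])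
                (t∈e ∷ x∈e ∷ y∈e ∷ z∈e ∷ []))
              (≤-reflexive ∣e∣≡3)))

      ≡triple : e ≡ triple x y z
      ≡triple = ⊆-antisym ⊆triple triple⊆e
        where
        triple⊆e : triple x y z ⊆ e
        triple⊆e t∈ with ∈-triple⁻ t∈
        ... | inj₁ refl        = x∈e
        ... | inj₂ (inj₁ refl) = y∈e
        ... | inj₂ (inj₂ refl) = z∈e

  ∃-third : ∀ {e : Subset n} {x y} → ∣ e ∣ ≡ 3 → x ∈ e → y ∈ e → ∃[ z ] (z ∈ e × z ≢ x × z ≢ y)
  ∃-third {e} {x} {y} ∣e∣≡3 x∈e y∈e with any? (λ z → (z ∈? e) ×-dec ¬? (z ≟ x) ×-dec ¬? (z ≟ y))
  ... | yes third = third
  ... | no  none  = ⊥-elim (<⇒≱ ≤-refl (begin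
      3                    ≡⟨ sym ∣e∣≡3 ⟩
      ∣ e ∣                ≤⟨ p⊆q⇒∣p∣≤∣q∣ e⊆xy ⟩
      ∣ ⁅ x ⁆ ∪ ⁅ y ⁆ ∣    ≤⟨ ∣p∪q∣≤∣p∣+∣q∣ ⁅ x ⁆ ⁅ y ⁆ ⟩
      ∣ ⁅ x ⁆ ∣ + ∣ ⁅ y ⁆ ∣ ≡⟨ cong₂ _+_ (∣⁅x⁆∣≡1 x) (∣⁅x⁆∣≡1 y) ⟩
      2                    ∎))
    where
    open ≤-Reasoning
    e⊆xy : e ⊆ ⁅ x ⁆ ∪ ⁅ y ⁆
    e⊆xy {t} t∈e with t ≟ x | t ≟ y
    ... | yes refl | _        = x∈p∪q⁺ (inj₁ (x∈⁅x⁆ x))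
    ... | no _     | yes refl = x∈p∪q⁺ (inj₂ (x∈⁅x⁆ y))
    ... | no t≢x   | no t≢y   = ⊥-elim (none (t , t∈e , t≢x , t≢y))

  ∃-element : ∀ {e : Subset n} → 0 < ∣ e ∣ → ∃[ x ] (x ∈ e)
  ∃-element {e} 0<∣e∣ with nonempty? e
  ... | yes x∈e = x∈e
  ... | no  ∅   = ⊥-elim (<⇒≱ 0<∣e∣ (≤-trans (p⊆q⇒∣p∣≤∣q∣ {q = ⊥} (λ x∈e → ⊥-elim (∅ (_ , x∈e))))
                                                (≤-reflexive (∣⊥∣≡0 n))))

  members : Subset n → List (Fin n)
  members e = filter (_∈? e) (allFin n)

  module _ {e : Subset n} {x : Fin n} (x∈e : x ∈ e) where

    minimum maximum : Fin n
    minimum = argmin toℕ x (members e)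
    maximum = argmax toℕ x (members e)

    minimum∈ : minimum ∈ e
    minimum∈ = argmin-all toℕ x∈e (all-filter (_∈? e) (allFin n))

    maximum∈ : maximum ∈ e
    maximum∈ = argmax-all toℕ x∈e (all-filter (_∈? e) (allFin n))

    minimum≤ : ∀ {y} → y ∈ e → toℕ minimum ≤ toℕ y
    minimum≤ {y} y∈e = All.lookup (f[argmin]≤f[xs] x (members e)) (∈-filter⁺ (_∈? e) (∈-allFin y) y∈e)

    ≤maximum : ∀ {y} → y ∈ e → toℕ y ≤ toℕ maximum
    ≤maximum {y} y∈e = All.lookup (f[xs]≤f[argmax] x (members e)) (∈-filter⁺ (_∈? e) (∈-allFin y) y∈e)

    minimum<maximum : ∀ {y} → y ∈ e → x ≢ y → toℕ minimum < toℕ maximum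
    minimum<maximum y∈e x≢y = ≤∧≢⇒< (≤-trans (minimum≤ x∈e) (≤maximum x∈e)) λ min≡max →
      x≢y (toℕ-injective (≤-antisym
        (≤-trans (≤maximum x∈e) (≤-trans (≤-reflexive (sym min≡max)) (minimum≤ y∈e)))
        (≤-trans (≤maximum y∈e) (≤-trans (≤-reflexive (sym min≡max)) (minimum≤ x∈e)))))

module _ {n : ℕ} {P : Fin n → Set} (P? : ∀ x → Dec (P x)) where

  select : Subset n
  select = tabulate (λ x → does (P? x))

  ∈-select⁺ : ∀ {x} → P x → x ∈ select
  ∈-select⁺ {x} Px = lookup⇒[]= x select (trans (lookup∘tabulate _ x) (dec-true (P? x) Px))

  ∈-select⁻ : ∀ {x} → x ∈ select → P x
  ∈-select⁻ {x} x∈ = witness (P? x) (trans (sym (lookup∘tabulate _ x)) ([]=⇒lookup x∈))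
    where
    witness : (d : Dec (P x)) → does d ≡ inside → P x
    witness (yes Px) _ = Px

module _ {n : ℕ} (H : Hypergraph3 n) where

  codeg-sym : ∀ u v → codeg H u v ≡ codeg H v u
  codeg-sym u v = cong length
    (filter-≐ (λ e → (u ∈? e) ×-dec (v ∈? e)) (λ e → (v ∈? e) ×-dec (u ∈? e)) (swap , swap) (edges H))

  module _ {u v : Fin n} (u≢v : u ≢ v) where

    ThirdsIn : Subset n → Subset n → Set
    ThirdsIn F e = ∣ e ∣ ≡ 3 × u ∈ e × v ∈ e × (∀ {z} → z ∈ e → z ≢ u → z ≢ v → z ∈ F)

    length≤∣F∣ : ∀ {F} es → Unique es → All (ThirdsIn F) es → length es ≤ ∣ F ∣
    length≤∣F∣ [] _ _ = z≤n
    length≤∣F∣ {F} (e ∷ es) (e∉es ∷ es!) ((∣e∣≡3 , u∈e , v∈e , e⊆F) ∷ thirds)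
      with z , z∈e , z≢u , z≢v ← ∃-third ∣e∣≡3 u∈e v∈e =
      ≤-trans (s≤s (length≤∣F∣ es es! (All.zipWith shrink (e∉es , thirds)))) (x∈p⇒∣p-x∣<∣p∣ (e⊆F z∈e z≢u z≢v))
      where
      ≡uvz : ∀ {f} → ThirdsIn F f → z ∈ f → f ≡ triple u v z
      ≡uvz (∣f∣≡3 , u∈f , v∈f , _) z∈f =
        ≡triple ∣f∣≡3 u∈f v∈f z∈f u≢v (λ u≡z → z≢u (sym u≡z)) (λ v≡z → z≢v (sym v≡z))
      shrink : ∀ {f} → e ≢ f × ThirdsIn F f → ThirdsIn (F - z) f
      shrink {f} (e≢f , thirdsf@(∣f∣≡3 , u∈f , v∈f , f⊆F)) = ∣f∣≡3 , u∈f , v∈f , λ y∈f y≢u y≢v →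
        x∈p∧x≢y⇒x∈p-y (f⊆F y∈f y≢u y≢v)
          (λ { refl → e≢f (trans (≡uvz (∣e∣≡3 , u∈e , v∈e , e⊆F) z∈e) (sym (≡uvz thirdsf y∈f))) })

    through? : ∀ e → Dec (u ∈ e × v ∈ e)
    through? e = (u ∈? e) ×-dec (v ∈? e)

    ∃-edge-with-third∉ : ∀ F → ∣ F ∣ < codeg H u v →
                         ∃[ z ] (z ∉ F × z ≢ u × z ≢ v × IsEdge H (triple u v z))
    ∃-edge-with-third∉ F ∣F∣<codeg with Any.any? third∉? (filter through? (edges H))
      where
      third∉? : ∀ e → Dec (∃[ z ] (z ∈ e × z ≢ u × z ≢ v × z ∉ F))
      third∉? e = any? (λ z → (z ∈? e) ×-dec ¬? (z ≟ u) ×-dec ¬? (z ≟ v) ×-dec ¬? (z ∈? F))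
    ... | yes some
      with e , e∈through , z , z∈e , z≢u , z≢v , z∉F ← find some
      with e∈H , u∈e , v∈e ← ∈-filter⁻ through? e∈through =
      z , z∉F , z≢u , z≢v ,
      subst (IsEdge H) (≡triple (All.lookup (uniform H) e∈H) u∈e v∈e z∈e u≢v
                          (λ u≡z → z≢u (sym u≡z)) (λ v≡z → z≢v (sym v≡z))) e∈H
    ... | no none = ⊥-elim (<⇒≱ ∣F∣<codeg
      (length≤∣F∣ (filter through? (edges H)) (Unique.filter⁺ through? (unique H))
        (All.zipWith thirds (filter⁺ through? (uniform H) ,
                             All.zip (all-filter through? (edges H) , ¬Any⇒All¬ _ none)))))
      where
      thirds : ∀ {e} → ∣ e ∣ ≡ 3 × (u ∈ e × v ∈ e) × ¬ (∃[ z ] (z ∈ e × z ≢ u × z ≢ v × z ∉ F)) → ThirdsIn F e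
      thirds {e} (∣e∣≡3 , (u∈e , v∈e) , no-third∉) = ∣e∣≡3 , u∈e , v∈e ,
        λ {z} z∈e z≢u z≢v → decidable-stable (z ∈? F) (λ z∉F → no-third∉ (z , z∈e , z≢u , z≢v , z∉F))

  record LoosePath₂ (u v : Fin n) (S : Subset n) : Set where
    field
      w p q   : Fin n
      edge₁   : IsEdge H (triple w u p)
      edge₂   : IsEdge H (triple v w q)
      w≢p     : w ≢ p
      w≢q     : w ≢ q
      p≢q     : p ≢ q
      avoids  : ∀ {y} → y ≡ u ⊎ y ≡ v ⊎ y ∈ S → y ≢ w × y ≢ p × y ≢ q

  simplePath⇒loosePath₂ : ∀ {u v S} → SimplePath2Avoiding H u v S → LoosePath₂ u v S
  simplePath⇒loosePath₂ {u} {v} {S}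
    (e₁ , e₂ , e₁∈H , e₂∈H , (w , w∈e₁ , w∈e₂) , ∣e₁∩e₂∣≤1 , (u∈e₁ , u∉e₂) , (v∈e₂ , v∉e₁) , S∩e=∅)
    with p , p∈e₁ , p≢w , p≢u ← ∃-third (All.lookup (uniform H) e₁∈H) w∈e₁ u∈e₁
       | q , q∈e₂ , q≢v , q≢w ← ∃-third (All.lookup (uniform H) e₂∈H) v∈e₂ w∈e₂ = record
    { w = w ; p = p ; q = q
    ; edge₁ = subst (IsEdge H) (≡triple (All.lookup (uniform H) e₁∈H) w∈e₁ u∈e₁ p∈e₁
                                  (≢-sym u≢w) (≢-sym p≢w) (≢-sym p≢u)) e₁∈H
    ; edge₂ = subst (IsEdge H) (≡triple (All.lookup (uniform H) e₂∈H) v∈e₂ w∈e₂ q∈e₂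
                                  v≢w (≢-sym q≢v) (≢-sym q≢w)) e₂∈H
    ; w≢p = ≢-sym p≢w
    ; w≢q = ≢-sym q≢w
    ; p≢q = λ { refl → p≢w (∣p∣≤1⇒≡ ∣e₁∩e₂∣≤1 (x∈p∩q⁺ (p∈e₁ , q∈e₂)) (x∈p∩q⁺ (w∈e₁ , w∈e₂))) }
    ; avoids = λ { (inj₁ refl)        → u≢w , ≢-sym p≢u , ∉⇒≢ u∉e₂ q∈e₂
                  ; (inj₂ (inj₁ refl)) → v≢w , ∉⇒≢ v∉e₁ p∈e₁ , ≢-sym q≢v
                  ; (inj₂ (inj₂ y∈S))  → ∉⇒≢ (∉e₁ y∈S) w∈e₁ , ∉⇒≢ (∉e₁ y∈S) p∈e₁ , ∉⇒≢ (∉e₂ y∈S) q∈e₂ }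
    }
    where
    ∉⇒≢ : ∀ {x y e} → y ∉ e → x ∈ e → y ≢ x
    ∉⇒≢ y∉e x∈e refl = y∉e x∈e
    u≢w : u ≢ w
    u≢w = ∉⇒≢ u∉e₂ w∈e₂
    v≢w : v ≢ w
    v≢w = ∉⇒≢ v∉e₁ w∈e₁
    ∉e₁ : ∀ {y} → y ∈ S → y ∉ e₁
    ∉e₁ y∈S y∈e₁ = S∩e=∅ _ (y∈S , x∈p∪q⁺ (inj₁ y∈e₁))
    ∉e₂ : ∀ {y} → y ∈ S → y ∉ e₂
    ∉e₂ y∈S y∈e₂ = S∩e=∅ _ (y∈S , x∈p∪q⁺ (inj₂ y∈e₂))

-- Loose cycles from joints and pendants

module _ (l : ℕ) where

  next : ℕ → ℕ
  next a with suc a ≟ℕ l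
  ... | yes _ = 0
  ... | no  _ = suc a

  next-< : ∀ {a} → 3 ≤ l → a < l → next a < l
  next-< {a} l≥3 a<l with suc a ≟ℕ l
  ... | yes _      = ≤-trans (s≤s z≤n) l≥3
  ... | no  1+a≢l = ≤∧≢⇒< a<l 1+a≢l

  next-injective : ∀ {a b} → next a ≡ next b → a ≡ b
  next-injective {a} {b} eq with suc a ≟ℕ l | suc b ≟ℕ l
  ... | yes 1+a≡l | yes 1+b≡l = suc-injective (trans 1+a≡l (sym 1+b≡l))
  ... | no  _     | no  _     = suc-injective eq
  next-injective () | yes _ | no _
  next-injective () | no _  | yes _

  next∘next≢id : ∀ {a} → 3 ≤ l → next (next a) ≢ a
  next∘next≢id {a} l≥3 eq with suc a ≟ℕ l
  next∘next≢id {a} l≥3 eq | yes 1+a≡l with 1 ≟ℕ l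
  ... | yes 1≡l = <⇒≱ (s≤s (s≤s z≤n)) (subst (3 ≤_) (sym 1≡l) l≥3)
  ... | no  _   = <⇒≱ ≤-refl (subst (3 ≤_) (trans (sym 1+a≡l) (cong suc (sym eq))) l≥3)
  next∘next≢id {a} l≥3 eq | no _ with suc (suc a) ≟ℕ l
  ... | yes 2+a≡l = <⇒≱ ≤-refl (subst (3 ≤_) (trans (sym 2+a≡l) (cong (λ b → suc (suc b)) (sym eq))) l≥3)
  ... | no  _     = <⇒≢ (m<n⇒m<1+n (n<1+n a)) (sym eq)

  next≡suc : ∀ {a} → suc a ≢ l → next a ≡ suc a
  next≡suc {a} 1+a≢l with suc a ≟ℕ l
  ... | yes 1+a≡l = ⊥-elim (1+a≢l 1+a≡l)
  ... | no  _     = refl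

  next≡0 : ∀ {a} → suc a ≡ l → next a ≡ 0
  next≡0 {a} 1+a≡l with suc a ≟ℕ l
  ... | yes _     = refl
  ... | no  1+a≢l = ⊥-elim (1+a≢l 1+a≡l)

  CycNext⇒next : ∀ {i j : Fin l} → CycNext i j → next (toℕ i) ≡ toℕ j
  CycNext⇒next {i} {j} i→j with suc (toℕ i) ≟ℕ l | i→j
  ... | yes 1+i≡l | inj₁ 1+i≡j       = ⊥-elim (<⇒≢ (toℕ<n j) (trans (sym 1+i≡j) 1+i≡l))
  ... | yes _     | inj₂ (_ , j≡0)   = sym j≡0
  ... | no  _     | inj₁ 1+i≡j       = 1+i≡j
  ... | no  1+i≢l | inj₂ (1+i≡l , _) = ⊥-elim (1+i≢l 1+i≡l)

  next⇒CycNext : ∀ {i j : Fin l} → next (toℕ i) ≡ toℕ j → CycNext i j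
  next⇒CycNext {i} eq with suc (toℕ i) ≟ℕ l
  ... | yes 1+i≡l = inj₂ (1+i≡l , sym eq)
  ... | no  _     = inj₁ eq

module _ {n l : ℕ} (l≥3 : 3 ≤ l) (H : Hypergraph3 n) (J P : ℕ → Fin n)
  (J-injective : ∀ {a b} → a < l → b < l → J a ≡ J b → a ≡ b)
  (P-injective : ∀ {a b} → a < l → b < l → P a ≡ P b → a ≡ b)
  (J≢P : ∀ {a b} → a < l → b < l → J a ≢ P b)
  (edge : ∀ {a} → a < l → IsEdge H (triple (J (next l a)) (J a) (P a))) where

  private
    c : ℕ → Subset n
    c a = triple (J (next l a)) (J a) (P a)

  common-joint : ∀ {a b y} → a < l → b < l → a ≢ b → y ∈ c a → y ∈ c b →
                 (next l b ≡ a × y ≡ J a) ⊎ (next l a ≡ b × y ≡ J b)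
  common-joint {a} {b} a<l b<l a≢b y∈a y∈b with ∈-triple⁻ y∈a | ∈-triple⁻ y∈b
  ... | inj₁ refl        | inj₁ eq          = ⊥-elim (a≢b (next-injective l (J-injective (next-< l l≥3 a<l) (next-< l l≥3 b<l) eq)))
  ... | inj₁ refl        | inj₂ (inj₁ eq)   = inj₂ (J-injective (next-< l l≥3 a<l) b<l eq , eq)
  ... | inj₁ refl        | inj₂ (inj₂ eq)   = ⊥-elim (J≢P (next-< l l≥3 a<l) b<l eq)
  ... | inj₂ (inj₁ refl) | inj₁ eq          = inj₁ (sym (J-injective a<l (next-< l l≥3 b<l) eq) , refl)
  ... | inj₂ (inj₁ refl) | inj₂ (inj₁ eq)   = ⊥-elim (a≢b (J-injective a<l b<l eq))
  ... | inj₂ (inj₁ refl) | inj₂ (inj₂ eq)   = ⊥-elim (J≢P a<l b<l eq)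
  ... | inj₂ (inj₂ refl) | inj₁ eq          = ⊥-elim (J≢P (next-< l l≥3 b<l) a<l (sym eq))
  ... | inj₂ (inj₂ refl) | inj₂ (inj₁ eq)   = ⊥-elim (J≢P b<l a<l (sym eq))
  ... | inj₂ (inj₂ refl) | inj₂ (inj₂ eq)   = ⊥-elim (a≢b (P-injective a<l b<l eq))

  ∣c∩c∣≡1 : ∀ {a b} → a < l → b < l → a ≢ b → next l a ≡ b → ∣ c a ∩ c b ∣ ≡ 1
  ∣c∩c∣≡1 {a} {b} a<l b<l a≢b refl = ∣p∣≡1 (x∈p∩q⁺ (x∈triple , y∈triple)) only-joint
    where
    only-joint : ∀ {y} → y ∈ c a ∩ c b → y ≡ J b
    only-joint y∈ with x∈p∩q⁻ (c a) (c b) y∈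
    ... | y∈a , y∈b with common-joint a<l b<l a≢b y∈a y∈b
    ...   | inj₁ (next²a≡a , _) = ⊥-elim (next∘next≢id l l≥3 next²a≡a)
    ...   | inj₂ (_ , y≡Jb)    = y≡Jb

  joints-pendants⇒looseCycle : ContainsLooseCycle l H
  joints-pendants⇒looseCycle = (λ i → c (toℕ i)) , (λ i → edge (toℕ<n i)) , λ i j i≢j →
    let i≢j′ : toℕ i ≢ toℕ j
        i≢j′ eq = i≢j (toℕ-injective eq) in
    (λ { (inj₁ i→j) → ∣c∩c∣≡1 (toℕ<n i) (toℕ<n j) i≢j′ (CycNext⇒next l i→j)
       ; (inj₂ j→i) → trans (cong ∣_∣ (∩-comm (c (toℕ i)) (c (toℕ j))))
                            (∣c∩c∣≡1 (toℕ<n j) (toℕ<n i) (≢-sym i≢j′) (CycNext⇒next l j→i)) }) ,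
    λ not-adjacent y (y∈i , y∈j) → not-adjacent (adjacent (common-joint (toℕ<n i) (toℕ<n j) i≢j′ y∈i y∈j))
    where
    adjacent : ∀ {i j : Fin l} {y} → (next l (toℕ j) ≡ toℕ i × y ≡ J (toℕ i)) ⊎ (next l (toℕ i) ≡ toℕ j × y ≡ J (toℕ j)) → CycAdj i j
    adjacent (inj₁ (j→i , _)) = inj₂ (next⇒CycNext l j→i)
    adjacent (inj₂ (i→j , _)) = inj₁ (next⇒CycNext l i→j)

-- Choosing pairwise distinct values greedily

module _ {A : Set} where

  override : (ℕ → A) → ℕ → A → ℕ → A
  override W t z i with i ≟ℕ t
  ... | yes _ = z
  ... | no  _ = W i

  override-≡ : ∀ W t z → override W t z t ≡ z
  override-≡ W t z with t ≟ℕ t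
  ... | yes _   = refl
  ... | no  t≢t = ⊥-elim (t≢t refl)

  override-≢ : ∀ {W t z i} → i ≢ t → override W t z i ≡ W i
  override-≢ {t = t} {i = i} i≢t with i ≟ℕ t
  ... | yes i≡t = ⊥-elim (i≢t i≡t)
  ... | no  _   = refl

module DistinctChoice {A : Set} (N : ℕ) (V : ℕ → A) {Free : ℕ → Set} (free? : ∀ t → Dec (Free t))
  (Good : ℕ → A → Set)
  (fresh : ∀ {t} → Free t → (W : ℕ → A) → ∃[ z ] (Good t z × ∀ {i} → i < N → i ≢ t → W i ≢ z)) where

  -- Positions are filled in increasing order: a free position avoids every value present when it
  -- is filled, and each later free position avoids it in turn.
  private
    stage : ℕ → ℕ → A
    stage zero    = V
    stage (suc s) with free? s
    ... | yes fs = override (stage s) s (proj₁ (fresh fs (stage s)))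
    ... | no  _  = stage s

    stage-≢ : ∀ {s i} → i ≢ s → stage (suc s) i ≡ stage s i
    stage-≢ {s} i≢s with free? s
    ... | yes _ = override-≢ i≢s
    ... | no  _ = refl

    stage-unvisited : ∀ {s i} → s ≤ i → stage s i ≡ V i
    stage-unvisited {zero}  _   = refl
    stage-unvisited {suc s} s<i = trans (stage-≢ (≢-sym (<⇒≢ s<i))) (stage-unvisited (<⇒≤ s<i))

    stage-settled : ∀ {s i} → i < s → stage s i ≡ stage (suc i) i
    stage-settled {suc s} {i} i<1+s with i ≟ℕ s
    ... | yes refl = refl
    ... | no  i≢s  = trans (stage-≢ i≢s) (stage-settled (≤∧≢⇒< (≤-pred i<1+s) i≢s))

    stage-not-free : ∀ {t} → ¬ Free t → stage (suc t) t ≡ V t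
    stage-not-free {t} ¬ft with free? t
    ... | yes ft = ⊥-elim (¬ft ft)
    ... | no  _  = stage-unvisited ≤-refl

    stage-chosen : ∀ {t} → Free t → Good t (stage (suc t) t) × ∀ {i} → i < N → i ≢ t → stage t i ≢ stage (suc t) t
    stage-chosen {t} ft with free? t
    ... | no ¬ft = ⊥-elim (¬ft ft)
    ... | yes ft′ with z , good , fresh-z ← fresh ft′ (stage t)
      rewrite override-≡ (stage t) t z = good , fresh-z

  greedy : ℕ → A
  greedy = stage N

  greedy-fixed : ∀ {i} → i < N → ¬ Free i → greedy i ≡ V i
  greedy-fixed i<N ¬fi = trans (stage-settled i<N) (stage-not-free ¬fi)

  greedy-good : ∀ {t} → t < N → Free t → Good t (greedy t)
  greedy-good {t} t<N ft = subst (Good t) (sym (stage-settled t<N)) (proj₁ (stage-chosen ft))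

  greedy-distinct : ∀ {i j} → i < N → j < N → i ≢ j → Free i → greedy i ≢ greedy j
  greedy-distinct {i} {j} i<N j<N i≢j fi
    rewrite stage-settled {N} i<N | stage-settled {N} j<N with <-cmp i j
  ... | tri< i<j _ _ = later (free? j)
    where
    later : Dec (Free j) → stage (suc i) i ≢ stage (suc j) j
    later (yes fj) eq = proj₂ (stage-chosen fj) i<N i≢j (trans (stage-settled i<j) eq)
    later (no ¬fj) eq = proj₂ (stage-chosen fi) j<N (≢-sym i≢j)
      (trans (stage-unvisited (<⇒≤ i<j)) (trans (sym (stage-not-free ¬fj)) (sym eq)))
  greedy-distinct {i} {j} i<N j<N i≢j fi | tri≈ _ i≡j _ = ⊥-elim (i≢j i≡j)
  greedy-distinct {i} {j} i<N j<N i≢j fi | tri> _ _ j<i =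
    λ eq → proj₂ (stage-chosen fi) j<N (≢-sym i≢j) (trans (stage-settled j<i) (sym eq))

-- Heights in a relation increasing along Fin

module _ {n : ℕ} {R : Fin n → Fin n → Set} (R? : ∀ a b → Dec (R a b))
  (R⇒< : ∀ {a b} → R a b → toℕ a < toℕ b) where

  predecessors : Fin n → List (Fin n)
  predecessors x = filter (λ a → R? a x) (allFin n)

  -- Recursion depth toℕ x + 1 suffices for x, since R increases toℕ.
  heightWithin : ℕ → Fin n → ℕ
  heightWithin zero    x = 0
  heightWithin (suc f) x = max 0 (map (suc ∘ heightWithin f) (predecessors x))

  height : Fin n → ℕ
  height x = heightWithin (suc (toℕ x)) x

  heightWithin-stable : ∀ {f g} x → toℕ x < f → toℕ x < g → heightWithin f x ≡ heightWithin g x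
  heightWithin-stable {suc f} {suc g} x x<1+f x<1+g =
    cong (max 0) (map-cong-local (All.map same-height (all-filter (λ a → R? a x) (allFin n))))
    where
    same-height : ∀ {a} → R a x → suc (heightWithin f a) ≡ suc (heightWithin g a)
    same-height Rax = cong suc (heightWithin-stable _ (<-≤-trans (R⇒< Rax) (≤-pred x<1+f))
                                                        (<-≤-trans (R⇒< Rax) (≤-pred x<1+g)))

  height≡heightWithin : ∀ {a x} → R a x → height a ≡ heightWithin (toℕ x) a
  height≡heightWithin {a} Rax = heightWithin-stable a ≤-refl (R⇒< Rax)

  height-< : ∀ {a x} → R a x → height a < height x
  height-< {a} {x} Rax = subst (λ h → suc h ≤ height x) (sym (height≡heightWithin Rax))
    (All.lookup (xs≤max 0 (map (suc ∘ heightWithin (toℕ x)) (predecessors x)))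
      (∈-map⁺ (suc ∘ heightWithin (toℕ x)) (∈-filter⁺ (λ b → R? b x) (∈-allFin a) Rax)))

  height-predecessor : ∀ {x} → 0 < height x → ∃[ a ] (R a x × height x ≡ suc (height a))
  height-predecessor {x} 0<h with argmax-sel id 0 (map (suc ∘ heightWithin (toℕ x)) (predecessors x))
  ... | inj₁ h≡0 = ⊥-elim (<⇒≢ 0<h (sym h≡0))
  ... | inj₂ h∈ with a , a∈ , h≡ ← ∈-map⁻ (suc ∘ heightWithin (toℕ x)) h∈
    with _ , Rax ← ∈-filter⁻ (λ b → R? b x) {xs = allFin n} a∈ = a , Rax , trans h≡ (cong suc (sym (height≡heightWithin Rax)))

  IsDescendingChain : ℕ → (ℕ → Fin n) → Set
  IsDescendingChain j B = ∀ {i} → i < j → R (B (suc i)) (B i)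

  ∃-chain-below : ∀ j x → j ≤ height x → ∃[ B ] (B 0 ≡ x × IsDescendingChain j B)
  ∃-chain-below zero    x _       = (λ _ → x) , refl , λ ()
  ∃-chain-below (suc j) x 1+j≤h
    with a , Rax , h≡1+ha ← height-predecessor (<-≤-trans (s≤s z≤n) 1+j≤h)
    with B , B0≡a , chain ← ∃-chain-below j a (≤-pred (subst (suc j ≤_) h≡1+ha 1+j≤h)) =
    x◂B , refl , steps
    where
    x◂B : ℕ → Fin n
    x◂B zero    = x
    x◂B (suc i) = B i
    steps : IsDescendingChain (suc j) x◂B
    steps {zero}  _         = subst (λ b → R b x) (sym B0≡a) Rax
    steps {suc i} (s≤s i<j) = chain i<j

module _ {n : ℕ} (X : Subset n) (c : Fin n → ℕ) where

  in-fibre? : ∀ j x → Dec (x ∈ X × c x ≡ j)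
  in-fibre? j x = (x ∈? X) ×-dec (c x ≟ℕ j)

  fibre : ℕ → Subset n
  fibre j = select (in-fibre? j)

  fibre⊆X : ∀ {j} → fibre j ⊆ X
  fibre⊆X {j} x∈ = proj₁ (∈-select⁻ (in-fibre? j) x∈)

  fibre-colour : ∀ {j x} → x ∈ fibre j → c x ≡ j
  fibre-colour {j} x∈ = proj₂ (∈-select⁻ (in-fibre? j) x∈)

  ∃-large-fibre : ∀ m → (∀ {x} → x ∈ X → c x < m) → ∃[ j ] (∣ X ∣ ≤ m * ∣ fibre j ∣)
  ∃-large-fibre m c<m = largest , ≤-trans (p⊆q⇒∣p∣≤∣q∣ X⊆below) (∣below∣≤ m ≤-refl)
    where
    largest : ℕ
    largest = argmax (∣_∣ ∘ fibre) 0 (upTo m)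

    ∣fibre∣≤ : ∀ {j} → j < m → ∣ fibre j ∣ ≤ ∣ fibre largest ∣
    ∣fibre∣≤ j<m = All.lookup (f[xs]≤f[argmax] 0 (upTo m)) (∈-upTo⁺ j<m)

    below? : ∀ t x → Dec (x ∈ X × c x < t)
    below? t x = (x ∈? X) ×-dec (c x <? t)

    below : ℕ → Subset n
    below t = select (below? t)

    X⊆below : X ⊆ below m
    X⊆below x∈X = ∈-select⁺ (below? m) (x∈X , c<m x∈X)

    below-suc : ∀ {t} → below (suc t) ⊆ below t ∪ fibre t
    below-suc {t} {x} x∈ with ∈-select⁻ (below? (suc t)) x∈ | c x ≟ℕ t
    ... | x∈X , _     | yes cx≡t = x∈p∪q⁺ (inj₂ (∈-select⁺ (in-fibre? t) (x∈X , cx≡t)))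
    ... | x∈X , cx<1+t | no cx≢t = x∈p∪q⁺ (inj₁ (∈-select⁺ (below? t) (x∈X , ≤∧≢⇒< (≤-pred cx<1+t) cx≢t)))

    ∣below∣≤ : ∀ t → t ≤ m → ∣ below t ∣ ≤ t * ∣ fibre largest ∣
    ∣below∣≤ zero    _     = ≤-trans (p⊆q⇒∣p∣≤∣q∣ {q = ⊥} (λ x∈ → ⊥-elim (n≮0 (proj₂ (∈-select⁻ (below? 0) x∈))))) (≤-reflexive (∣⊥∣≡0 n))
    ∣below∣≤ (suc t) 1+t≤m = begin
      ∣ below (suc t) ∣                       ≤⟨ p⊆q⇒∣p∣≤∣q∣ below-suc ⟩
      ∣ below t ∪ fibre t ∣                   ≤⟨ ∣p∪q∣≤∣p∣+∣q∣ (below t) (fibre t) ⟩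
      ∣ below t ∣ + ∣ fibre t ∣               ≤⟨ +-mono-≤ (∣below∣≤ t (<⇒≤ 1+t≤m)) (∣fibre∣≤ 1+t≤m) ⟩
      t * ∣ fibre largest ∣ + ∣ fibre largest ∣ ≡⟨ +-comm (t * ∣ fibre largest ∣) _ ⟩
      suc t * ∣ fibre largest ∣               ∎
      where open ≤-Reasoning

module _ {n : ℕ} (l : ℕ) (H : Hypergraph3 n) where

  heavy? : ∀ u v → Dec (Heavy l H u v)
  heavy? u v = ¬? (u ≟ v) ×-dec (2 * l ∸ 2 ≤? codeg H u v)

  heavy-sym : ∀ {u v} → Heavy l H u v → Heavy l H v u
  heavy-sym {u} {v} (u≢v , heavy) = ≢-sym u≢v , subst (2 * l ∸ 2 ≤_) (codeg-sym H u v) heavy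

module _ {n : ℕ} (l : ℕ) (H : Hypergraph3 n) (X : Subset n) where

  Within : Fin n → Fin n → Subset n → Set
  Within a b e = ∀ y → y ∈ e → toℕ a ≤ toℕ y × toℕ y ≤ toℕ b

  LightStep : Fin n → Fin n → Set
  LightStep a b = ∃[ e ] (LightEdge l H e × e ⊆ X × a ∈ e × b ∈ e × Within a b e)

  Step : Fin n → Fin n → Set
  Step a b = toℕ a < toℕ b × a ∈ X × b ∈ X × (Heavy l H a b ⊎ LightStep a b)

  lightStep? : ∀ a b → Dec (LightStep a b)
  lightStep? a b with Any.any? suitable? (edges H)
    where
    suitable? : ∀ e → Dec ((∀ u v → u ∈ e → v ∈ e → ¬ Heavy l H u v) × e ⊆ X × a ∈ e × b ∈ e × Within a b e)
    suitable? e = all? (λ u → all? (λ v → (u ∈? e) →-dec (v ∈? e) →-dec ¬? (heavy? l H u v)))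
             ×-dec (e ⊆? X) ×-dec (a ∈? e) ×-dec (b ∈? e)
             ×-dec all? (λ y → (y ∈? e) →-dec (toℕ a ≤? toℕ y) ×-dec (toℕ y ≤? toℕ b))
  ... | yes some with e , e∈H , no-heavy , rest ← find some = yes (e , (e∈H , no-heavy) , rest)
  ... | no  none = no λ (e , (e∈H , no-heavy) , rest) → none (lose e∈H (no-heavy , rest))

  step? : ∀ a b → Dec (Step a b)
  step? a b = (toℕ a <? toℕ b) ×-dec (a ∈? X) ×-dec (b ∈? X) ×-dec (heavy? l H a b ⊎-dec lightStep? a b)

  step-middle : ∀ {a b} → Step a b → ¬ Heavy l H a b →
                ∃[ c ] (toℕ a < toℕ c × toℕ c < toℕ b × c ∈ X × IsEdge H (triple a b c))
  step-middle     (_   , _ , _ , inj₁ heavy) light = ⊥-elim (light heavy)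
  step-middle {a} {b} (a<b , _ , _ , inj₂ (e , (e∈H , _) , e⊆X , a∈e , b∈e , within)) _
    with c , c∈e , c≢a , c≢b ← ∃-third (All.lookup (uniform H) e∈H) a∈e b∈e =
    c , ≤∧≢⇒< (proj₁ (within c c∈e)) (λ a≡c → c≢a (toℕ-injective (sym a≡c))) ,
        ≤∧≢⇒< (proj₂ (within c c∈e)) (λ c≡b → c≢b (toℕ-injective c≡b)) ,
        e⊆X c∈e ,
        subst (IsEdge H) (≡triple (All.lookup (uniform H) e∈H) a∈e b∈e c∈e
                            (λ a≡b → <⇒≢ a<b (cong toℕ a≡b)) (≢-sym c≢a) (≢-sym c≢b)) e∈H

  antichain-independent : ∀ {Z} → Z ⊆ X → (∀ {a b} → a ∈ Z → b ∈ Z → ¬ Step a b) →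
                          Independent (StarEdge l H) Z
  antichain-independent Z⊆X no-step e (inj₂ (u , v , heavy@(u≢v , _) , refl)) e⊆Z
    with u∈Z ← e⊆Z (x∈p∪q⁺ (inj₁ (x∈⁅x⁆ u))) | v∈Z ← e⊆Z (x∈p∪q⁺ (inj₂ (x∈⁅x⁆ v)))
    with <-cmp (toℕ u) (toℕ v)
  ... | tri< u<v _ _ = no-step u∈Z v∈Z (u<v , Z⊆X u∈Z , Z⊆X v∈Z , inj₁ heavy)
  ... | tri≈ _ u≡v _ = u≢v (toℕ-injective u≡v)
  ... | tri> _ _ v<u = no-step v∈Z u∈Z (v<u , Z⊆X v∈Z , Z⊆X u∈Z , inj₁ (heavy-sym l H heavy))
  antichain-independent Z⊆X no-step e (inj₁ light@(e∈H , _)) e⊆Z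
    with ∣e∣≡3 ← All.lookup (uniform H) e∈H
    with x , x∈e ← ∃-element (subst (0 <_) (sym ∣e∣≡3) (s≤s z≤n))
    with y , y∈e , y≢x , _ ← ∃-third ∣e∣≡3 x∈e x∈e =
    no-step (e⊆Z (minimum∈ x∈e)) (e⊆Z (maximum∈ x∈e))
      (minimum<maximum x∈e y∈e (≢-sym y≢x) , Z⊆X (e⊆Z (minimum∈ x∈e)) , Z⊆X (e⊆Z (maximum∈ x∈e)) ,
       inj₂ (e , light , (λ y∈e → Z⊆X (e⊆Z y∈e)) , minimum∈ x∈e , maximum∈ x∈e ,
             λ y y∈e → minimum≤ x∈e y∈e , ≤maximum x∈e y∈e))

-- A chain of l - 2 steps closes up into a loose cycle of length l

module ChainCycle {n : ℕ} (k : ℕ) (H : Hypergraph3 n) (X Y : Subset n) (extender : Extender (3 + k) H X Y)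
  (A : ℕ → Fin n) (steps : ∀ {i} → i < suc k → Step (3 + k) H X (A (suc i)) (A i)) where

  private
    m l : ℕ
    m = suc k
    l = suc (suc m)

    X∩Y=∅ : Disjoint X Y
    X∩Y=∅ = proj₁ extender

    closing-path : ∀ u v → u ∈ X → v ∈ X → u ≢ v → ∀ S → (∀ x → x ∈ S → x ≢ u × x ≢ v × x ∉ Y) →
                   ∣ S ∣ ≤ 2 * l ∸ 5 → SimplePath2Avoiding H u v S
    closing-path = proj₁ (proj₂ extender)

  A-decreasing : ∀ {i j} → i < j → j ≤ m → toℕ (A j) < toℕ (A i)
  A-decreasing {i} {suc j} i<1+j 1+j≤m with i ≟ℕ j
  ... | yes refl = proj₁ (steps 1+j≤m)
  ... | no  i≢j  = <-trans (proj₁ (steps 1+j≤m)) (A-decreasing (≤∧≢⇒< (≤-pred i<1+j) i≢j) (<⇒≤ 1+j≤m))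

  A-antitone : ∀ {i j} → i ≤ j → j ≤ m → toℕ (A j) ≤ toℕ (A i)
  A-antitone {i} {j} i≤j j≤m with i ≟ℕ j
  ... | yes refl = ≤-refl
  ... | no  i≢j  = <⇒≤ (A-decreasing (≤∧≢⇒< i≤j i≢j) j≤m)

  A-injective : ∀ {i j} → i ≤ m → j ≤ m → A i ≡ A j → i ≡ j
  A-injective {i} {j} i≤m j≤m eq with <-cmp i j
  ... | tri< i<j _ _ = ⊥-elim (<⇒≢ (A-decreasing i<j j≤m) (cong toℕ (sym eq)))
  ... | tri≈ _ i≡j _ = i≡j
  ... | tri> _ _ j<i = ⊥-elim (<⇒≢ (A-decreasing j<i i≤m) (cong toℕ eq))

  A∈X : ∀ {i} → i ≤ m → A i ∈ X
  A∈X {i} i≤m with i ≟ℕ m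
  ... | yes refl = proj₁ (proj₂ (steps {k} ≤-refl))
  ... | no  i≢m  = proj₁ (proj₂ (proj₂ (steps (≤∧≢⇒< i≤m i≢m))))

  HeavyAt LightAt : ℕ → Set
  HeavyAt t = t < m × Heavy l H (A (suc t)) (A t)
  LightAt t = t < m × ¬ Heavy l H (A (suc t)) (A t)

  heavyAt? : ∀ t → Dec (HeavyAt t)
  heavyAt? t = (t <? m) ×-dec heavy? l H (A (suc t)) (A t)

  lightAt? : ∀ t → Dec (LightAt t)
  lightAt? t = (t <? m) ×-dec ¬? (heavy? l H (A (suc t)) (A t))

  middle : ℕ → Fin n
  middle t with lightAt? t
  ... | yes (t<m , light) = proj₁ (step-middle l H X (steps t<m) light)
  ... | no  _             = A t

  middle-spec : ∀ {t} → LightAt t → toℕ (A (suc t)) < toℕ (middle t) × toℕ (middle t) < toℕ (A t)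
                                  × middle t ∈ X × IsEdge H (triple (A (suc t)) (A t) (middle t))
  middle-spec {t} light-t with lightAt? t
  ... | yes (t<m , light) = proj₂ (step-middle l H X (steps t<m) light)
  ... | no  ¬light        = ⊥-elim (¬light light-t)

  module _ {t} (light-t : LightAt t) where

    A<middle : toℕ (A (suc t)) < toℕ (middle t)
    A<middle = proj₁ (middle-spec light-t)

    middle<A : toℕ (middle t) < toℕ (A t)
    middle<A = proj₁ (proj₂ (middle-spec light-t))

    middle∈X : middle t ∈ X
    middle∈X = proj₁ (proj₂ (proj₂ (middle-spec light-t)))

    middle-edge : IsEdge H (triple (A (suc t)) (A t) (middle t))
    middle-edge = proj₂ (proj₂ (proj₂ (middle-spec light-t)))

    A≢middle : ∀ {a} → a ≤ m → A a ≢ middle t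
    A≢middle {a} a≤m A≡middle with a ≤? t
    ... | yes a≤t = <⇒≢ (<-≤-trans middle<A (A-antitone a≤t (<⇒≤ (proj₁ light-t)))) (cong toℕ (sym A≡middle))
    ... | no  a≰t = <⇒≢ (≤-<-trans (A-antitone (≰⇒> a≰t) a≤m) A<middle) (cong toℕ A≡middle)

  middle-injective : ∀ {s t} → LightAt s → LightAt t → middle s ≡ middle t → s ≡ t
  middle-injective {s} {t} light-s light-t eq with <-cmp s t
  ... | tri< s<t _ _ = ⊥-elim (<⇒≢ (<-trans (middle<A light-t) (≤-<-trans (A-antitone s<t (<⇒≤ (proj₁ light-t)))
                                    (A<middle light-s))) (cong toℕ (sym eq)))
  ... | tri≈ _ s≡t _ = s≡t
  ... | tri> _ _ t<s = ⊥-elim (<⇒≢ (<-trans (middle<A light-s) (≤-<-trans (A-antitone t<s (<⇒≤ (proj₁ light-s)))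
                                    (A<middle light-t))) (cong toℕ eq))

  S : Subset n
  S = fromList (applyUpTo (A ∘ suc) k ++ map middle (filter lightAt? (upTo m)))

  ∣S∣≤2l∸5 : ∣ S ∣ ≤ 2 * l ∸ 5
  ∣S∣≤2l∸5 = begin
    ∣ S ∣                                         ≤⟨ ∣fromList∣≤length (applyUpTo (A ∘ suc) k ++ middles) ⟩
    length (applyUpTo (A ∘ suc) k ++ middles)     ≡⟨ length-++ (applyUpTo (A ∘ suc) k) ⟩
    length (applyUpTo (A ∘ suc) k) + length middles ≡⟨ cong₂ _+_ (length-applyUpTo (A ∘ suc) k) (length-map middle lights) ⟩
    k + length lights                             ≤⟨ +-monoʳ-≤ k (≤-trans (length-filter lightAt? (upTo m)) (≤-reflexive (length-upTo m))) ⟩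
    k + m                                         ≡⟨ cong (_∸ 5) (2*[3+k]≡5+[k+1+k] k) ⟨
    2 * l ∸ 5                                     ∎
    where
    open ≤-Reasoning
    lights = filter lightAt? (upTo m)
    middles = map middle lights
    2*[3+k]≡5+[k+1+k] : ∀ k → 2 * (3 + k) ≡ 5 + (k + suc k)
    2*[3+k]≡5+[k+1+k] = solve-∀

  ∈S⁻ : ∀ {y} → y ∈ S → ∃[ i ] (i < k × y ≡ A (suc i)) ⊎ ∃[ t ] (LightAt t × y ≡ middle t)
  ∈S⁻ y∈S with ∈-++⁻ (applyUpTo (A ∘ suc) k) (∈-fromList⁻ _ y∈S)
  ... | inj₁ y∈interior = inj₁ (∈-applyUpTo⁻ (A ∘ suc) y∈interior)
  ... | inj₂ y∈middles with t , t∈lights , y≡middle ← ∈-map⁻ middle y∈middles =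
    inj₂ (t , proj₂ (∈-filter⁻ lightAt? {xs = upTo m} t∈lights) , y≡middle)

  A∈S : ∀ {a} → 0 < a → a < m → A a ∈ S
  A∈S {suc i} _ 1+i<m = ∈-fromList⁺ (∈-++⁺ˡ (∈-applyUpTo⁺ (A ∘ suc) (≤-pred 1+i<m)))

  middle∈S : ∀ {t} → LightAt t → middle t ∈ S
  middle∈S {t} light-t@(t<m , _) = ∈-fromList⁺ (∈-++⁺ʳ (applyUpTo (A ∘ suc) k)
    (∈-map⁺ middle (∈-filter⁺ lightAt? (∈-upTo⁺ t<m) light-t)))

  S-avoids : ∀ y → y ∈ S → y ≢ A m × y ≢ A 0 × y ∉ Y
  S-avoids y y∈S with ∈S⁻ y∈S
  ... | inj₁ (i , i<k , refl) =
        (λ eq → <⇒≢ (s≤s i<k) (A-injective (s≤s (<⇒≤ i<k)) ≤-refl eq)) ,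
        (λ eq → 1+n≢0 (A-injective (s≤s (<⇒≤ i<k)) z≤n eq)) ,
        λ y∈Y → X∩Y=∅ y (A∈X (s≤s (<⇒≤ i<k)) , y∈Y)
  ... | inj₂ (t , light-t , refl) =
        (λ eq → A≢middle light-t ≤-refl (sym eq)) ,
        (λ eq → A≢middle light-t z≤n (sym eq)) ,
        λ y∈Y → X∩Y=∅ y (middle∈X light-t , y∈Y)

  closing : LoosePath₂ H (A m) (A 0) S
  closing = simplePath⇒loosePath₂ H
    (closing-path (A m) (A 0) (A∈X ≤-refl) (A∈X z≤n) (λ eq → 1+n≢0 (A-injective ≤-refl z≤n eq))
      S S-avoids ∣S∣≤2l∸5)

  open LoosePath₂ closing

  A-outer : ∀ {a} → a ≤ m → A a ≡ A m ⊎ A a ≡ A 0 ⊎ A a ∈ S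
  A-outer {a} a≤m with a ≟ℕ 0 | a ≟ℕ m
  ... | yes refl | _        = inj₂ (inj₁ refl)
  ... | no  _    | yes refl = inj₁ refl
  ... | no  a≢0  | no  a≢m  = inj₂ (inj₂ (A∈S (n≢0⇒n>0 a≢0) (≤∧≢⇒< a≤m a≢m)))

  A-avoids : ∀ {a} → a ≤ m → A a ≢ w × A a ≢ p × A a ≢ q
  A-avoids a≤m = avoids (A-outer a≤m)

  middle-avoids : ∀ {t} → LightAt t → middle t ≢ w × middle t ≢ p × middle t ≢ q
  middle-avoids light-t = avoids (inj₂ (inj₂ (middle∈S light-t)))

  J : ℕ → Fin n
  J a with a ≤? m
  ... | yes _ = A a
  ... | no  _ = w

  J≡A : ∀ {a} → a ≤ m → J a ≡ A a
  J≡A {a} a≤m with a ≤? m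
  ... | yes _   = refl
  ... | no  a≰m = ⊥-elim (a≰m a≤m)

  J≡w : J (suc m) ≡ w
  J≡w with suc m ≤? m
  ... | yes 1+m≤m = ⊥-elim (<-irrefl refl 1+m≤m)
  ... | no  _     = refl

  J≡A-next : ∀ {a} → a < m → J (next l a) ≡ A (suc a)
  J≡A-next a<m = trans (cong J (next≡suc l (λ 1+a≡l → <⇒≢ (m<n⇒m<1+n (s≤s a<m)) 1+a≡l))) (J≡A a<m)

  JointView : ℕ → Set
  JointView a = (a ≤ m × J a ≡ A a) ⊎ (a ≡ suc m × J a ≡ w)

  joint-view : ∀ {a} → a < l → JointView a
  joint-view {a} a<l with a ≤? m
  ... | yes a≤m = inj₁ (a≤m , refl)
  ... | no  a≰m = inj₂ (≤-antisym (≤-pred a<l) (≰⇒> a≰m) , refl)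

  J-injective : ∀ {a b} → a < l → b < l → J a ≡ J b → a ≡ b
  J-injective {a} {b} a<l b<l Ja≡Jb with joint-view a<l | joint-view b<l
  ... | inj₁ (a≤m , Ja≡) | inj₁ (b≤m , Jb≡) = A-injective a≤m b≤m (trans (sym Ja≡) (trans Ja≡Jb Jb≡))
  ... | inj₁ (a≤m , Ja≡) | inj₂ (_ , Jb≡)   = ⊥-elim (proj₁ (A-avoids a≤m) (trans (sym Ja≡) (trans Ja≡Jb Jb≡)))
  ... | inj₂ (_ , Ja≡)   | inj₁ (b≤m , Jb≡) = ⊥-elim (proj₁ (A-avoids b≤m) (trans (sym Jb≡) (trans (sym Ja≡Jb) Ja≡)))
  ... | inj₂ (a≡ , _)    | inj₂ (b≡ , _)    = trans a≡ (sym b≡)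

  pendant : (t : ℕ) → Dec (t < m) → Dec (t ≡ m) → Fin n
  pendant t (yes _) _       = middle t
  pendant t (no  _) (yes _) = p
  pendant t (no  _) (no  _) = q

  V : ℕ → Fin n
  V t = pendant t (t <? m) (t ≟ℕ m)

  FixedView : ℕ → Set
  FixedView t = (LightAt t × V t ≡ middle t) ⊎ (t ≡ m × V t ≡ p) ⊎ (t ≡ suc m × V t ≡ q)

  fixed-view : ∀ {t} → t < l → ¬ HeavyAt t → FixedView t
  fixed-view {t} t<l ¬heavy = view (t <? m) (t ≟ℕ m)
    where
    view : (t<?m : Dec (t < m)) (t≟m : Dec (t ≡ m)) → let x = pendant t t<?m t≟m in
           (LightAt t × x ≡ middle t) ⊎ (t ≡ m × x ≡ p) ⊎ (t ≡ suc m × x ≡ q)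
    view (yes t<m) _         = inj₁ ((t<m , λ heavy → ¬heavy (t<m , heavy)) , refl)
    view (no  _)   (yes t≡m) = inj₂ (inj₁ (t≡m , refl))
    view (no  t≮m) (no  t≢m) = inj₂ (inj₂ (≤-antisym (≤-pred t<l) (≤∧≢⇒< (≮⇒≥ t≮m) (≢-sym t≢m)) , refl))

  fixed-distinct : ∀ {i j} → i < l → j < l → i ≢ j → ¬ HeavyAt i → ¬ HeavyAt j → V i ≢ V j
  fixed-distinct {i} {j} i<l j<l i≢j ¬hi ¬hj Vi≡Vj = distinct (fixed-view i<l ¬hi) (fixed-view j<l ¬hj)
    where
    via : ∀ {x y} → V i ≡ x → V j ≡ y → x ≡ y
    via Vi≡ Vj≡ = trans (sym Vi≡) (trans Vi≡Vj Vj≡)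
    distinct : FixedView i → FixedView j → Empty
    distinct (inj₁ (light-i , Vi≡))  (inj₁ (light-j , Vj≡))  = i≢j (middle-injective light-i light-j (via Vi≡ Vj≡))
    distinct (inj₁ (light-i , Vi≡))  (inj₂ (inj₁ (_ , Vj≡))) = proj₁ (proj₂ (middle-avoids light-i)) (via Vi≡ Vj≡)
    distinct (inj₁ (light-i , Vi≡))  (inj₂ (inj₂ (_ , Vj≡))) = proj₂ (proj₂ (middle-avoids light-i)) (via Vi≡ Vj≡)
    distinct (inj₂ (inj₁ (_ , Vi≡))) (inj₁ (light-j , Vj≡))  = proj₁ (proj₂ (middle-avoids light-j)) (sym (via Vi≡ Vj≡))
    distinct (inj₂ (inj₂ (_ , Vi≡))) (inj₁ (light-j , Vj≡))  = proj₂ (proj₂ (middle-avoids light-j)) (sym (via Vi≡ Vj≡))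
    distinct (inj₂ (inj₁ (i≡m , _))) (inj₂ (inj₁ (j≡m , _))) = i≢j (trans i≡m (sym j≡m))
    distinct (inj₂ (inj₁ (_ , Vi≡))) (inj₂ (inj₂ (_ , Vj≡))) = p≢q (via Vi≡ Vj≡)
    distinct (inj₂ (inj₂ (_ , Vi≡))) (inj₂ (inj₁ (_ , Vj≡))) = p≢q (sym (via Vi≡ Vj≡))
    distinct (inj₂ (inj₂ (i≡ , _)))  (inj₂ (inj₂ (j≡ , _)))  = i≢j (trans i≡ (sym j≡))

  J≢fixed : ∀ {a b} → a < l → b < l → ¬ HeavyAt b → J a ≢ V b
  J≢fixed {a} {b} a<l b<l ¬hb Ja≡Vb = distinct (joint-view a<l) (fixed-view b<l ¬hb)
    where
    via : ∀ {x y} → J a ≡ x → V b ≡ y → x ≡ y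
    via Ja≡ Vb≡ = trans (sym Ja≡) (trans Ja≡Vb Vb≡)
    distinct : JointView a → FixedView b → Empty
    distinct (inj₁ (a≤m , Ja≡)) (inj₁ (light-b , Vb≡))  = A≢middle light-b a≤m (via Ja≡ Vb≡)
    distinct (inj₁ (a≤m , Ja≡)) (inj₂ (inj₁ (_ , Vb≡))) = proj₁ (proj₂ (A-avoids a≤m)) (via Ja≡ Vb≡)
    distinct (inj₁ (a≤m , Ja≡)) (inj₂ (inj₂ (_ , Vb≡))) = proj₂ (proj₂ (A-avoids a≤m)) (via Ja≡ Vb≡)
    distinct (inj₂ (_ , Ja≡))   (inj₁ (light-b , Vb≡))  = proj₁ (middle-avoids light-b) (sym (via Ja≡ Vb≡))
    distinct (inj₂ (_ , Ja≡))   (inj₂ (inj₁ (_ , Vb≡))) = w≢p (via Ja≡ Vb≡)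
    distinct (inj₂ (_ , Ja≡))   (inj₂ (inj₂ (_ , Vb≡))) = w≢q (via Ja≡ Vb≡)

  joints : Subset n
  joints = fromList (applyUpTo J l)

  J∈joints : ∀ {a} → a < l → J a ∈ joints
  J∈joints a<l = ∈-fromList⁺ (∈-applyUpTo⁺ J a<l)

  -- A third vertex outside this set avoids all joints and all pendants W i.  Resetting W t to the
  -- joint A t makes both lists contain it, which brings the size down to 2l - 3.
  avoided : ℕ → (ℕ → Fin n) → Subset n
  avoided t W = (joints - A (suc t) - A t) ∪ (fromList (applyUpTo (override W t (A t)) l) - A t)

  3+∣avoided∣≤2l : ∀ {t} → t < m → ∀ W → 3 + ∣ avoided t W ∣ ≤ 2 * l
  3+∣avoided∣≤2l {t} t<m W = begin
    3 + ∣ avoided t W ∣                                    ≤⟨ +-monoʳ-≤ 3 (∣p∪q∣≤∣p∣+∣q∣ (joints - u - v) (pendants - v)) ⟩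
    3 + (∣ joints - u - v ∣ + ∣ pendants - v ∣)            ≡⟨ 3+[a+b]≡[2+a]+[1+b] ∣ joints - u - v ∣ ∣ pendants - v ∣ ⟩
    (2 + ∣ joints - u - v ∣) + (1 + ∣ pendants - v ∣)      ≤⟨ +-mono-≤
      (≤-trans (s≤s (x∈p⇒∣p-x∣<∣p∣ v∈joints-u)) (≤-trans (x∈p⇒∣p-x∣<∣p∣ u∈joints) (∣fromList∣≤l J)))
      (≤-trans (x∈p⇒∣p-x∣<∣p∣ v∈pendants) (∣fromList∣≤l W′)) ⟩
    l + l                                                  ≡⟨ cong (l +_) (+-identityʳ l) ⟨
    2 * l                                                  ∎
    where
    open ≤-Reasoning
    u v : Fin n
    u = A (suc t)
    v = A t
    W′ : ℕ → Fin n
    W′ = override W t v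
    pendants : Subset n
    pendants = fromList (applyUpTo W′ l)
    t<l : t < l
    t<l = m<n⇒m<1+n (m<n⇒m<1+n t<m)
    u∈joints : u ∈ joints
    u∈joints = subst (_∈ joints) (J≡A t<m) (J∈joints (m<n⇒m<1+n (s≤s t<m)))
    v∈joints-u : v ∈ joints - u
    v∈joints-u = x∈p∧x≢y⇒x∈p-y (subst (_∈ joints) (J≡A (<⇒≤ t<m)) (J∈joints t<l))
                               (λ v≡u → <⇒≢ (A-decreasing (n<1+n t) t<m) (cong toℕ (sym v≡u)))
    v∈pendants : v ∈ pendants
    v∈pendants = subst (_∈ pendants) (override-≡ W t v) (∈-fromList⁺ (∈-applyUpTo⁺ W′ t<l))
    3+[a+b]≡[2+a]+[1+b] : ∀ a b → 3 + (a + b) ≡ (2 + a) + (1 + b)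
    3+[a+b]≡[2+a]+[1+b] = solve-∀
    ∣fromList∣≤l : ∀ f → ∣ fromList (applyUpTo f l) ∣ ≤ l
    ∣fromList∣≤l f = ≤-trans (∣fromList∣≤length (applyUpTo f l)) (≤-reflexive (length-applyUpTo f l))

  Good : ℕ → Fin n → Set
  Good t z = IsEdge H (triple (A (suc t)) (A t) z) × (∀ {a} → a < l → J a ≢ z)

  fresh : ∀ {t} → HeavyAt t → (W : ℕ → Fin n) → ∃[ z ] (Good t z × ∀ {i} → i < l → i ≢ t → W i ≢ z)
  fresh {t} (t<m , u≢v , 2l∸2≤codeg) W
    with z , z∉avoided , z≢u , z≢v , edge
           ← ∃-edge-with-third∉ H u≢v (avoided t W) (<-≤-trans (∸-monoˡ-≤ 2 (3+∣avoided∣≤2l t<m W)) 2l∸2≤codeg) =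
    z , (edge , joint≢z) , pendant≢z
    where
    joint≢z : ∀ {a} → a < l → J a ≢ z
    joint≢z a<l refl = z∉avoided (x∈p∪q⁺ (inj₁ (x∈p∧x≢y⇒x∈p-y (x∈p∧x≢y⇒x∈p-y (J∈joints a<l) z≢u) z≢v)))
    pendant≢z : ∀ {i} → i < l → i ≢ t → W i ≢ z
    pendant≢z {i} i<l i≢t refl = z∉avoided (x∈p∪q⁺ (inj₂ (x∈p∧x≢y⇒x∈p-y
      (subst (_∈ fromList (applyUpTo (override W t (A t)) l)) (override-≢ i≢t)
             (∈-fromList⁺ (∈-applyUpTo⁺ (override W t (A t)) i<l))) z≢v)))

  open DistinctChoice l V heavyAt? Good fresh
    using (greedy-fixed; greedy-good; greedy-distinct) renaming (greedy to P)

  P-injective : ∀ {a b} → a < l → b < l → P a ≡ P b → a ≡ b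
  P-injective {a} {b} a<l b<l Pa≡Pb with a ≟ℕ b | heavyAt? a | heavyAt? b
  ... | yes a≡b | _       | _       = a≡b
  ... | no  a≢b | yes ha  | _       = ⊥-elim (greedy-distinct a<l b<l a≢b ha Pa≡Pb)
  ... | no  a≢b | no  _   | yes hb  = ⊥-elim (greedy-distinct b<l a<l (≢-sym a≢b) hb (sym Pa≡Pb))
  ... | no  a≢b | no  ¬ha | no  ¬hb = ⊥-elim (fixed-distinct a<l b<l a≢b ¬ha ¬hb
      (trans (sym (greedy-fixed a<l ¬ha)) (trans Pa≡Pb (greedy-fixed b<l ¬hb))))

  J≢P : ∀ {a b} → a < l → b < l → J a ≢ P b
  J≢P {a} {b} a<l b<l with heavyAt? b
  ... | yes hb  = proj₂ (greedy-good b<l hb) a<l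
  ... | no  ¬hb = subst (J a ≢_) (sym (greedy-fixed b<l ¬hb)) (J≢fixed a<l b<l ¬hb)

  cycle-edge : ∀ {a} → a < l → IsEdge H (triple (J (next l a)) (J a) (P a))
  cycle-edge {a} a<l = edge-at (heavyAt? a)
    where
    retarget : ∀ {x y z} → J (next l a) ≡ x → J a ≡ y → P a ≡ z → IsEdge H (triple x y z) →
               IsEdge H (triple (J (next l a)) (J a) (P a))
    retarget refl refl refl e = e

    fixed-edge : ¬ HeavyAt a → FixedView a → IsEdge H (triple (J (next l a)) (J a) (P a))
    fixed-edge ¬ha (inj₁ (light-a@(a<m , _) , Va≡)) =
      retarget (J≡A-next a<m) (J≡A (<⇒≤ a<m)) (trans (greedy-fixed a<l ¬ha) Va≡) (middle-edge light-a)
    fixed-edge ¬ha (inj₂ (inj₁ (refl , Va≡))) =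
      retarget (trans (cong J (next≡suc l (<⇒≢ ≤-refl))) J≡w) (J≡A ≤-refl) (trans (greedy-fixed a<l ¬ha) Va≡) edge₁
    fixed-edge ¬ha (inj₂ (inj₂ (refl , Va≡))) =
      retarget (trans (cong J (next≡0 l refl)) (J≡A z≤n)) J≡w (trans (greedy-fixed a<l ¬ha) Va≡) edge₂

    edge-at : Dec (HeavyAt a) → IsEdge H (triple (J (next l a)) (J a) (P a))
    edge-at (yes ha@(a<m , _)) = retarget (J≡A-next a<m) (J≡A (<⇒≤ a<m)) refl (proj₁ (greedy-good a<l ha))
    edge-at (no  ¬ha)          = fixed-edge ¬ha (fixed-view a<l ¬ha)

  looseCycle : ContainsLooseCycle (3 + k) H
  looseCycle = joints-pendants⇒looseCycle (s≤s (s≤s (s≤s z≤n))) H J P J-injective P-injective J≢P cycle-edge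

lemma4p4 : (l n : ℕ) → 3 ≤ l → (H : Hypergraph3 n) → ¬ ContainsLooseCycle l H →
    (X Y : Subset n) → Extender l H X Y →
    ∃[ Z ] (Z ⊆ X × Independent (StarEdge l H) Z × ∣ X ∣ ≤ (l ∸ 2) * ∣ Z ∣)
lemma4p4 (suc (suc zero)) _ (s≤s (s≤s ())) _ _ _ _ _
lemma4p4 (suc (suc (suc k))) n _ H no-cycle X Y extender =
  let j , ∣X∣≤ = ∃-large-fibre X rank (suc k) (λ {x} _ → rank<1+k x) in
  fibre X rank j , fibre⊆X X rank , antichain-independent l H X (fibre⊆X X rank) (same-rank⇒no-step j) , ∣X∣≤
  where
  l : ℕ
  l = 3 + k

  rank : Fin n → ℕ
  rank = height (step? l H X) proj₁

  rank<1+k : ∀ x → rank x < suc k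
  rank<1+k x = bounded (suc k ≤? rank x)
    where
    bounded : Dec (suc k ≤ rank x) → rank x < suc k
    bounded (no  1+k≰rank) = ≰⇒> 1+k≰rank
    bounded (yes 1+k≤rank) =
      let B , _ , steps = ∃-chain-below (step? l H X) proj₁ (suc k) x 1+k≤rank
      in ⊥-elim (no-cycle (ChainCycle.looseCycle k H X Y extender B steps))

  same-rank⇒no-step : ∀ j {a b} → a ∈ fibre X rank j → b ∈ fibre X rank j → ¬ Step l H X a b
  same-rank⇒no-step j a∈ b∈ step =
    <⇒≢ (height-< (step? l H X) proj₁ step) (trans (fibre-colour X rank a∈) (sym (fibre-colour X rank b∈)))
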